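{- Let $J\ge 1$ and let $x_1,\dots,x_J$ be positive reals with $x_1\cdots x_J=1$. Then the average, over the $J$ cyclic permutations $(x_{t+1},\dots,x_{t+J})$ ($t=1,\dots,J$, indices mod $J$) of $(x_1,\dots,x_J)$, of \[ \Big(\sum_{i=1}^J x_{t+1}\cdots x_{t+i}\Big)^{ -1} \] is exactly $1/J$. -}

module Defs where

open import Level using (Level; suc; _⊔_)
open import Data.Nat as ℕ using (ℕ; zero; NonZero; _%_)
import Data.Nat.DivMod as DM
open import Data.Fin using (Fin; fromℕ<)
open import Relation.Nullary using (¬_)
open import Relation.Binary.Structures using (IsStrictTotalOrder)
open import Algebra.Bundles using (CommutativeRing)

-- An ordered field (ℝ is the intended model): a commutative ring with a
-- strict total order compatible with + and *, and a (total) reciprocal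
-- operation which is a genuine inverse on every nonzero element
-- (its value at 0 is irrelevant).
record OrderedField (c ℓ₁ ℓ₂ : Level) : Set (suc (c ⊔ ℓ₁ ⊔ ℓ₂)) where
  field
    commutativeRing : CommutativeRing c ℓ₁
  open CommutativeRing commutativeRing public
  field
    _<_               : Carrier → Carrier → Set ℓ₂
    isStrictTotalOrder : IsStrictTotalOrder _≈_ _<_
    +-mono-<          : ∀ {x y} z → x < y → (x + z) < (y + z)
    *-pos             : ∀ {x y} → 0# < x → 0# < y → 0# < (x * y)
    _⁻¹               : Carrier → Carrier
    ⁻¹-inverse        : ∀ x → ¬ (x ≈ 0#) → (x * (x ⁻¹)) ≈ 1#

module OrderedFieldOps {c ℓ₁ ℓ₂} (F : OrderedField c ℓ₁ ℓ₂) where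
  open OrderedField F public

  sumTo : ℕ → (ℕ → Carrier) → Carrier
  sumTo zero    f = 0#
  sumTo (ℕ.suc n) f = sumTo n f + f n

  prodTo : ℕ → (ℕ → Carrier) → Carrier
  prodTo zero    f = 1#
  prodTo (ℕ.suc n) f = prodTo n f * f n

  fromℕ : ℕ → Carrier
  fromℕ zero    = 0#
  fromℕ (ℕ.suc n) = fromℕ n + 1#

  -- x_1,…,x_J are stored 0-based as x : Fin J → Carrier; cyclic access
  -- x at index k mod J.
  cyc : (J : ℕ) .{{_ : NonZero J}} → (Fin J → Carrier) → ℕ → Carrier
  cyc J x k = x (fromℕ< (DM.m%n<n k J))

  -- For the cyclic shift by t:  Σ_{i=1}^{J} x_{t+1} ⋯ x_{t+i}
  -- (0-based: Σ_{i=1}^{J} Π_{j<i} x_{(t+j) mod J}).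
  cycSum : (J : ℕ) .{{_ : NonZero J}} → (Fin J → Carrier) → ℕ → Carrier
  cycSum J x t = sumTo J (λ i → prodTo (ℕ.suc i) (λ j → cyc J x (t ℕ.+ j)))

module Submission where

-- Write C k = x_{k mod J} and let Q k = C 0 ⋯ C (k-1) be the
-- partial products (Q 0 = 1).  Since C 0 ⋯ C (J-1) = 1 and C is J-periodic,
-- Q is J-periodic too.  Multiplying the t-th cyclic sum S_t by Q t turns every
-- product x_{t+1}⋯x_{t+i} into the partial product Q (t+i+1), so
-- Q t · S_t = Q (t+1) + ⋯ + Q (t+J), a window of length J of a J-periodic
-- sequence, which equals Y = Q 0 + ⋯ + Q (J-1) independently of t.  Hence
-- 1/S_t = Q t / Y and Σ_t 1/S_t = Y / Y = 1; the theorem follows after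
-- multiplying by 1/J.

open import Defs
open import Data.Nat using (ℕ; NonZero)
open import Data.Fin using (Fin)
import Data.Nat as N
import Data.Nat.Properties as NP
import Data.Nat.DivMod as DM
import Data.Fin.Properties as FP
import Relation.Binary.PropositionalEquality as P
open import Relation.Binary.Structures using (IsStrictTotalOrder)
open import Relation.Nullary using (¬_)

module FiniteSums {c ℓ₁ ℓ₂} (F : OrderedField c ℓ₁ ℓ₂) where
  open OrderedFieldOps F
  open import Relation.Binary.Reasoning.Setoid setoid
  private module STO = IsStrictTotalOrder isStrictTotalOrder

  sumTo-cong : ∀ n {f g : ℕ → Carrier} → (∀ i → f i ≈ g i) → sumTo n f ≈ sumTo n g
  sumTo-cong ℕ.zero    eq = refl
  sumTo-cong (ℕ.suc n) eq = +-cong (sumTo-cong n eq) (eq n)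

  prodTo-cong : ∀ n {f g : ℕ → Carrier} → (∀ i → f i ≈ g i) → prodTo n f ≈ prodTo n g
  prodTo-cong ℕ.zero    eq = refl
  prodTo-cong (ℕ.suc n) eq = *-cong (prodTo-cong n eq) (eq n)

  prodTo-split : ∀ t n (f : ℕ → Carrier) →
                 prodTo (t N.+ n) f ≈ prodTo t f * prodTo n (λ j → f (t N.+ j))
  prodTo-split t ℕ.zero    f rewrite NP.+-identityʳ t = sym (*-identityʳ _)
  prodTo-split t (ℕ.suc n) f rewrite NP.+-suc t n =
    trans (*-cong (prodTo-split t n f) refl) (*-assoc _ _ _)

  *-sumTo : ∀ n a (f : ℕ → Carrier) → a * sumTo n f ≈ sumTo n (λ i → a * f i)
  *-sumTo ℕ.zero    a f = zeroʳ a
  *-sumTo (ℕ.suc n) a f = trans (distribˡ _ _ _) (+-cong (*-sumTo n a f) refl)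

  sumTo-unconsˡ : ∀ n (f : ℕ → Carrier) →
                  sumTo (ℕ.suc n) f ≈ f 0 + sumTo n (λ i → f (ℕ.suc i))
  sumTo-unconsˡ ℕ.zero    f = +-comm _ _
  sumTo-unconsˡ (ℕ.suc n) f = trans (+-cong (sumTo-unconsˡ n f) refl) (+-assoc _ _ _)

  sumTo-shift : ∀ n (f : ℕ → Carrier) → f n ≈ f 0 →
                sumTo n (λ i → f (ℕ.suc i)) ≈ sumTo n f
  sumTo-shift ℕ.zero    f _     = refl
  sumTo-shift (ℕ.suc m) f f-end = begin
    sumTo m (λ i → f (ℕ.suc i)) + f (ℕ.suc m) ≈⟨ +-comm _ _ ⟩
    f (ℕ.suc m) + sumTo m (λ i → f (ℕ.suc i)) ≈⟨ +-cong f-end refl ⟩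
    f 0 + sumTo m (λ i → f (ℕ.suc i))         ≈⟨ sym (sumTo-unconsˡ m f) ⟩
    sumTo (ℕ.suc m) f                         ∎

  sumTo-periodic : ∀ n (g : ℕ → Carrier) → (∀ k → g (n N.+ k) ≈ g k) →
                   ∀ t → sumTo n (λ i → g (t N.+ i)) ≈ sumTo n g
  sumTo-periodic n g periodic ℕ.zero    = refl
  sumTo-periodic n g periodic (ℕ.suc t) = begin
    sumTo n (λ i → g (ℕ.suc t N.+ i))  ≈⟨ sumTo-cong n (λ i → reflexive (P.cong g (P.sym (NP.+-suc t i)))) ⟩
    sumTo n (λ i → g (t N.+ ℕ.suc i))  ≈⟨ sumTo-shift n (λ i → g (t N.+ i)) window-closes ⟩
    sumTo n (λ i → g (t N.+ i))        ≈⟨ sumTo-periodic n g periodic t ⟩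
    sumTo n g                          ∎
    where
    window-closes : g (t N.+ n) ≈ g (t N.+ 0)
    window-closes = begin
      g (t N.+ n) ≡⟨ P.cong g (NP.+-comm t n) ⟩
      g (n N.+ t) ≈⟨ periodic t ⟩
      g t         ≡⟨ P.cong g (P.sym (NP.+-identityʳ t)) ⟩
      g (t N.+ 0) ∎

  pos⇒≉0 : ∀ {a} → 0# < a → ¬ (a ≈ 0#)
  pos⇒≉0 a>0 a≈0 = STO.irrefl (sym a≈0) a>0

  +-pos : ∀ {a b} → 0# < a → 0# < b → 0# < (a + b)
  +-pos {a} {b} a>0 b>0 = STO.trans (STO.<-respʳ-≈ (sym (+-identityˡ b)) b>0) (+-mono-< b a>0)

  prodTo-pos : ∀ {f : ℕ → Carrier} → (∀ j → 0# < f j) → ∀ n → 0# < prodTo (ℕ.suc n) f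
  prodTo-pos f>0 ℕ.zero    = STO.<-respʳ-≈ (sym (*-identityˡ _)) (f>0 0)
  prodTo-pos f>0 (ℕ.suc n) = *-pos (prodTo-pos f>0 n) (f>0 (ℕ.suc n))

  sumTo-pos : ∀ {f : ℕ → Carrier} → (∀ j → 0# < f j) → ∀ n → 0# < sumTo (ℕ.suc n) f
  sumTo-pos f>0 ℕ.zero    = STO.<-respʳ-≈ (sym (+-identityˡ _)) (f>0 0)
  sumTo-pos f>0 (ℕ.suc n) = +-pos (sumTo-pos f>0 n) (f>0 (ℕ.suc n))

  ⁻¹-from-product : ∀ {q s y} → s * s ⁻¹ ≈ 1# → y * y ⁻¹ ≈ 1# → q * s ≈ y →
                    s ⁻¹ ≈ y ⁻¹ * q
  ⁻¹-from-product {q} {s} {y} s-inv y-inv qs≈y = begin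
    s ⁻¹                         ≈⟨ sym (*-identityˡ _) ⟩
    1# * s ⁻¹                    ≈⟨ *-cong (trans (sym y-inv) (*-comm _ _)) refl ⟩
    (y ⁻¹ * y) * s ⁻¹            ≈⟨ *-cong (*-cong refl (sym qs≈y)) refl ⟩
    (y ⁻¹ * (q * s)) * s ⁻¹      ≈⟨ *-cong (sym (*-assoc _ _ _)) refl ⟩
    ((y ⁻¹ * q) * s) * s ⁻¹      ≈⟨ *-assoc _ _ _ ⟩
    (y ⁻¹ * q) * (s * s ⁻¹)      ≈⟨ *-cong refl s-inv ⟩
    (y ⁻¹ * q) * 1#              ≈⟨ *-identityʳ _ ⟩
    y ⁻¹ * q                     ∎

module CyclicSums {c ℓ₁ ℓ₂} (F : OrderedField c ℓ₁ ℓ₂) (m : ℕ)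
                  (x : Fin (ℕ.suc m) → OrderedField.Carrier F)
                  (x>0 : ∀ k → OrderedField._<_ F (OrderedField.0# F) (x k))
                  (prod≈1 : OrderedField._≈_ F
                              (OrderedFieldOps.prodTo F (ℕ.suc m) (OrderedFieldOps.cyc F (ℕ.suc m) x))
                              (OrderedField.1# F)) where
  open OrderedFieldOps F
  open FiniteSums F
  open import Relation.Binary.Reasoning.Setoid setoid

  J : ℕ
  J = ℕ.suc m

  C : ℕ → Carrier
  C = cyc J x

  Q : ℕ → Carrier
  Q k = prodTo k C

  Y : Carrier
  Y = sumTo J Q

  C-periodic : ∀ j → C (J N.+ j) P.≡ C j
  C-periodic j = P.cong x (FP.fromℕ<-cong _ _
    (P.trans (P.cong (N._% J) (NP.+-comm J j)) (DM.[m+n]%n≡m%n j J)) _ _)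

  -- Q is J-periodic because a full period contributes the factor Q J = 1.
  Q-periodic : ∀ k → Q (J N.+ k) ≈ Q k
  Q-periodic k = begin
    Q (J N.+ k)                         ≈⟨ prodTo-split J k C ⟩
    Q J * prodTo k (λ j → C (J N.+ j))  ≈⟨ *-cong prod≈1 (prodTo-cong k (λ j → reflexive (C-periodic j))) ⟩
    1# * Q k                            ≈⟨ *-identityˡ _ ⟩
    Q k                                 ∎

  -- Key identity: Q t · S_t = Q (t+1) + ⋯ + Q (t+J) = Y.
  Q*cycSum≈Y : ∀ t → Q t * cycSum J x t ≈ Y
  Q*cycSum≈Y t = begin
    Q t * cycSum J x t
      ≈⟨ *-sumTo J (Q t) _ ⟩
    sumTo J (λ i → Q t * prodTo (ℕ.suc i) (λ j → C (t N.+ j)))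
      ≈⟨ sumTo-cong J (λ i → trans (sym (prodTo-split t (ℕ.suc i) C))
                                   (reflexive (P.cong Q (NP.+-suc t i)))) ⟩
    sumTo J (λ i → Q (ℕ.suc t N.+ i))
      ≈⟨ sumTo-periodic J Q Q-periodic (ℕ.suc t) ⟩
    Y ∎

  cycSum-pos : ∀ t → 0# < cycSum J x t
  cycSum-pos t = sumTo-pos (λ i → prodTo-pos (λ j → x>0 _) i) m

  Y-pos : 0# < Y
  Y-pos = STO.<-respʳ-≈ (trans (sym (*-identityˡ _)) (Q*cycSum≈Y 0)) (cycSum-pos 0)
    where module STO = IsStrictTotalOrder isStrictTotalOrder

  Y-inverse : Y * Y ⁻¹ ≈ 1#
  Y-inverse = ⁻¹-inverse Y (pos⇒≉0 Y-pos)

  sum-reciprocals≈1 : sumTo J (λ t → (cycSum J x t) ⁻¹) ≈ 1#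
  sum-reciprocals≈1 = begin
    sumTo J (λ t → (cycSum J x t) ⁻¹)
      ≈⟨ sumTo-cong J (λ t → ⁻¹-from-product (⁻¹-inverse _ (pos⇒≉0 (cycSum-pos t)))
                                              Y-inverse (Q*cycSum≈Y t)) ⟩
    sumTo J (λ t → Y ⁻¹ * Q t)  ≈⟨ sym (*-sumTo J (Y ⁻¹) Q) ⟩
    Y ⁻¹ * Y                    ≈⟨ trans (*-comm _ _) Y-inverse ⟩
    1#                          ∎

lemma4p2 : ∀ {c ℓ₁ ℓ₂} (F : OrderedField c ℓ₁ ℓ₂) →
           let open OrderedFieldOps F in
           (J : ℕ) .{{_ : NonZero J}} (x : Fin J → Carrier) →
           (∀ k → 0# < x k) →
           prodTo J (cyc J x) ≈ 1# →
           ((fromℕ J) ⁻¹ * sumTo J (λ t → (cycSum J x t) ⁻¹)) ≈ (fromℕ J) ⁻¹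
lemma4p2 F (ℕ.suc m) x x>0 prod≈1 =
  trans (*-cong refl (sum-reciprocals≈1 m x x>0 prod≈1)) (*-identityʳ _)
  where open OrderedFieldOps F
        open CyclicSums F
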